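{- Let $G$ be a finite digraph with $n$ vertices (arrows are ordered pairs). Suppose every arrow of $G$ belongs to at least one subdigraph consisting of three distinct vertices $u,v,w$ and the three arrows $(u,v)$, $(u,w)$, $(v,w)$. Then there exist a colour function $\Xi:A(G)\to\mathbb{Z}_2^3$ and a weight function on $A(G)$ such that $G$ equipped with them is the union digraph of some $n$-dimensional algebra over $\mathbb{F}$ with respect to some basis.
   Context: $\mathbb{F}$ is an algebraically closed field of characteristic zero; an algebra is a finite-dimensional $\mathbb{F}$-vector space with bilinear product $*$; for a basis $\{e_1,\dots,e_n\}$ write $e_i*e_j=\sum_k c_{ij}^k e_k$. The operands digraph $G_O(A)$ has an arrow $e_i\to e_j$ iff $e_i*e_j\ne0$; $G_R(A)$ has an arrow $e_i\to e_k$ iff $c_{ij}^k\ne0$ for some $j$; $G_L(A)$ has an arrow $e_j\to e_k$ iff $c_{ij}^k\ne0$ for some $i$. The union digraph $G_U(A)$ has vertices $e_1,\dots,e_n$, arrow set the union of the arrow sets of $G_O(A),G_R(A),G_L(A)$, colour $\Xi(\alpha)\in\mathbb{Z}_2^3$ whose three coordinates indicate membership of $\alpha$ in $G_O(A),G_R(A),G_L(A)$ respectively, and weight in $\mathbb{F}^{3n}$ formed from the weights of the arrow in these three digraphs (zero where absent); the weight of an arrow $e_i\to e_k$ in $G_R(A)$ is $(c_{ij}^k)_j$, in $G_L(A)$ an arrow $e_j\to e_k$ has weight $(c_{ij}^k)_i$, and in $G_O(A)$ an arrow $e_i\to e_j$ has weight $(c_{ij}^k)_k$. -}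

module Defs where

open import Level using (Level; _⊔_)
open import Data.Nat using (ℕ; zero; suc)
open import Data.Fin using (Fin)
open import Data.Bool using (Bool; true)
open import Data.List using (List; []; _∷_; length)
open import Data.Product using (Σ; ∃; ∃-syntax; _×_; _,_)
open import Data.Sum using (_⊎_)
open import Relation.Nullary using (¬_)
open import Relation.Binary.PropositionalEquality using (_≡_)
open import Algebra.Bundles using (CommutativeRing)
open import Function.Bundles using (_⇔_)

record Field (c ℓ : Level) : Set (Level.suc (c ⊔ ℓ)) where
  field
    commutativeRing : CommutativeRing c ℓ
  open CommutativeRing commutativeRing public
  field
    0≉1     : ¬ (0# ≈ 1#)
    inverse : ∀ x → ¬ (x ≈ 0#) → ∃[ y ] (x * y ≈ 1#)

module _ {c ℓ : Level} (F : Field c ℓ) where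
  open Field F

  -- Evaluation of the monic polynomial
  --   x^d + a_{d-1} x^{d-1} + ... + a_1 x + a_0
  -- given by the coefficient list  a_0 ∷ a_1 ∷ ... ∷ a_{d-1} ∷ []  (d = length).
  evalMonic : List Carrier → Carrier → Carrier
  evalMonic []       x = 1#
  evalMonic (a ∷ as) x = a + x * evalMonic as x

  AlgebraicallyClosed : Set (c ⊔ ℓ)
  AlgebraicallyClosed =
    ∀ (as : List Carrier) → ¬ (length as ≡ 0) → ∃[ x ] (evalMonic as x ≈ 0#)

  natF : ℕ → Carrier
  natF zero    = 0#
  natF (suc m) = 1# + natF m

  CharZero : Set ℓ
  CharZero = ∀ (m : ℕ) → ¬ (natF (suc m) ≈ 0#)

  -- An n-dimensional algebra with respect to a basis e_1..e_n is given by
  -- its structure constants:  c i j k = c_{ij}^k,  e_i * e_j = Σ_k c_{ij}^k e_k.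

  StructureConstants : ℕ → Set c
  StructureConstants n = Fin n → Fin n → Fin n → Carrier

  module _ {n : ℕ} (γ : StructureConstants n) where

    ArrowO : Fin n → Fin n → Set ℓ
    ArrowO i j = ∃[ k ] ¬ (γ i j k ≈ 0#)

    ArrowR : Fin n → Fin n → Set ℓ
    ArrowR i k = ∃[ j ] ¬ (γ i j k ≈ 0#)

    ArrowL : Fin n → Fin n → Set ℓ
    ArrowL j k = ∃[ i ] ¬ (γ i j k ≈ 0#)

    ArrowU : Fin n → Fin n → Set ℓ
    ArrowU a b = ArrowO a b ⊎ ArrowR a b ⊎ ArrowL a b

    weightO : Fin n → Fin n → Fin n → Carrier
    weightO a b k = γ a b k
    weightR : Fin n → Fin n → Fin n → Carrier
    weightR a b j = γ a j b
    weightL : Fin n → Fin n → Fin n → Carrier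
    weightL a b i = γ i a b

  -- Z_2^3, coordinates for (G_O, G_R, G_L)
  Colour : Set
  Colour = Bool × Bool × Bool

  -- Weight in F^{3n}: the three F^n-blocks coming from G_O, G_R, G_L.
  Weight : ℕ → Set c
  Weight n = (Fin n → Carrier) × (Fin n → Carrier) × (Fin n → Carrier)

  BlockMatches : ∀ {n} → Set ℓ → (Fin n → Carrier) → (Fin n → Carrier) → Set ℓ
  BlockMatches inX block w =
    (inX → ∀ t → block t ≈ w t) × (¬ inX → ∀ t → block t ≈ 0#)

  IsUnionDigraph : ∀ {n} (γ : StructureConstants n) (G : Fin n → Fin n → Bool)
    (Ξ : ∀ a b → G a b ≡ true → Colour) (ω : ∀ a b → G a b ≡ true → Weight n) →
    Set ℓ
  IsUnionDigraph γ G Ξ ω =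
    (∀ a b → (G a b ≡ true) ⇔ ArrowU γ a b)
    × (∀ a b (p : G a b ≡ true) →
         let (xO , xR , xL) = Ξ a b p in
         ((xO ≡ true) ⇔ ArrowO γ a b)
         × ((xR ≡ true) ⇔ ArrowR γ a b)
         × ((xL ≡ true) ⇔ ArrowL γ a b))
    × (∀ a b (p : G a b ≡ true) →
         let (wO , wR , wL) = ω a b p in
         BlockMatches (ArrowO γ a b) wO (weightO γ a b)
         × BlockMatches (ArrowR γ a b) wR (weightR γ a b)
         × BlockMatches (ArrowL γ a b) wL (weightL γ a b))

InTransitiveTriangle : ∀ {n} → (Fin n → Fin n → Bool) → Fin n → Fin n → Set
InTransitiveTriangle {n} G a b =
  ∃[ u ] ∃[ v ] ∃[ w ]
    (¬ (u ≡ v) × ¬ (u ≡ w) × ¬ (v ≡ w))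
    × (G u v ≡ true) × (G u w ≡ true) × (G v w ≡ true)
    × (((a ≡ u) × (b ≡ v)) ⊎ ((a ≡ u) × (b ≡ w)) ⊎ ((a ≡ v) × (b ≡ w)))

module Submission where

-- Take the algebra with c_{ij}^k = 1 if (i,j), (i,k), (j,k) are all arrows of G, and 0
-- otherwise. Each arrow of G_O, G_R or G_L is then a side of a transitive triangle of G,
-- hence an arrow of G; conversely an arrow of G lying in a triangle u → v → w as
-- (u,v), (u,w) or (v,w) is produced by c_{uv}^w in G_O, G_R or G_L respectively.

open import Defs
open import Level using (Level)
open import Data.Nat using (ℕ)
open import Data.Fin using (Fin)
open import Data.Fin.Properties using (any?)
open import Data.Bool using (Bool; true; false; _∧_; if_then_else_)
open import Data.Bool.Properties using (∧-conicalˡ; ∧-conicalʳ) renaming (_≟_ to _≟ᵇ_)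
open import Data.Product using (∃-syntax; _,_)
open import Data.Sum using (inj₁; inj₂)
open import Data.Empty using (⊥-elim)
open import Function using (_∘_)
open import Function.Bundles using (_⇔_; mk⇔)
open import Relation.Binary.PropositionalEquality using (_≡_; refl)
open import Relation.Nullary using (¬_; yes; no; does)

module IndicatorAlgebra {c ℓ : Level} (F : Field c ℓ) where
  open Field F using (Carrier; _≈_; 0#; 1#; 0≉1) renaming (refl to ≈-refl; sym to ≈-sym)

  indicator : Bool → Carrier
  indicator b = if b then 1# else 0#

  indicator-≉0 : ∀ {b} → b ≡ true → ¬ (indicator b ≈ 0#)
  indicator-≉0 refl 1≈0 = 0≉1 (≈-sym 1≈0)

  indicator-≉0⁻ : ∀ b → ¬ (indicator b ≈ 0#) → b ≡ true
  indicator-≉0⁻ true  _    = refl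
  indicator-≉0⁻ false 0≉0 = ⊥-elim (0≉0 ≈-refl)

  indicator-≈0 : ∀ b → ¬ (b ≡ true) → indicator b ≈ 0#
  indicator-≈0 true  b≢true = ⊥-elim (b≢true refl)
  indicator-≈0 false _      = ≈-refl

  module _ {n : ℕ} where

    anyTrue : (Fin n → Bool) → Bool
    anyTrue f = does (any? (λ x → f x ≟ᵇ true))

    anyTrue⇔indicator-≉0 : ∀ f → (anyTrue f ≡ true) ⇔ (∃[ x ] ¬ (indicator (f x) ≈ 0#))
    anyTrue⇔indicator-≉0 f with any? (λ x → f x ≟ᵇ true)
    ... | yes (x , fx≡true) = mk⇔ (λ _ → x , indicator-≉0 fx≡true) (λ _ → refl)
    ... | no  ¬∃           = mk⇔ (λ ()) (λ (x , fx≉0) → ⊥-elim (¬∃ (x , indicator-≉0⁻ (f x) fx≉0)))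

    indicator-blockMatches : ∀ f →
      BlockMatches F {n} (∃[ x ] ¬ (indicator (f x) ≈ 0#)) (indicator ∘ f) (indicator ∘ f)
    indicator-blockMatches f =
        (λ _ _ → ≈-refl)
      , (λ ¬∃ t → indicator-≈0 (f t) (λ ft≡true → ¬∃ (t , indicator-≉0 ft≡true)))

    module _ (β : Fin n → Fin n → Fin n → Bool) where

      indicatorAlgebra : StructureConstants F n
      indicatorAlgebra i j k = indicator (β i j k)

      indicatorColour : Fin n → Fin n → Colour F
      indicatorColour a b =
        anyTrue (λ k → β a b k) , anyTrue (λ j → β a j b) , anyTrue (λ i → β i a b)

      unionWeight : Fin n → Fin n → Weight F n
      unionWeight a b =
          weightO F indicatorAlgebra a b
        , weightR F indicatorAlgebra a b
        , weightL F indicatorAlgebra a b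

      isUnionDigraph : (G : Fin n → Fin n → Bool) →
        (∀ a b → (G a b ≡ true) ⇔ ArrowU F indicatorAlgebra a b) →
        IsUnionDigraph F indicatorAlgebra G
          (λ a b _ → indicatorColour a b) (λ a b _ → unionWeight a b)
      isUnionDigraph G arrows =
          arrows
        , (λ a b _ → anyTrue⇔indicator-≉0 (λ k → β a b k)
                   , anyTrue⇔indicator-≉0 (λ j → β a j b)
                   , anyTrue⇔indicator-≉0 (λ i → β i a b))
        , (λ a b _ → indicator-blockMatches (λ k → β a b k)
                   , indicator-blockMatches (λ j → β a j b)
                   , indicator-blockMatches (λ i → β i a b))

module TransitiveTriangleAlgebra {c ℓ : Level} (F : Field c ℓ) {n : ℕ}
                                 (G : Fin n → Fin n → Bool) where
  open IndicatorAlgebra F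

  transitiveTriangle : Fin n → Fin n → Fin n → Bool
  transitiveTriangle u v w = G u v ∧ G u w ∧ G v w

  triangleAlgebra : StructureConstants F n
  triangleAlgebra = indicatorAlgebra transitiveTriangle

  transitiveTriangle-intro : ∀ {u v w} → G u v ≡ true → G u w ≡ true → G v w ≡ true →
                             transitiveTriangle u v w ≡ true
  transitiveTriangle-intro uv uw vw rewrite uv | uw | vw = refl

  arrowU⇒arrow : ∀ a b → ArrowU F triangleAlgebra a b → G a b ≡ true
  arrowU⇒arrow a b (inj₁ (k , ≉0)) =
    ∧-conicalˡ _ _ (indicator-≉0⁻ _ ≉0)
  arrowU⇒arrow a b (inj₂ (inj₁ (j , ≉0))) =
    ∧-conicalˡ _ _ (∧-conicalʳ (G a j) _ (indicator-≉0⁻ _ ≉0))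
  arrowU⇒arrow a b (inj₂ (inj₂ (i , ≉0))) =
    ∧-conicalʳ (G i b) _ (∧-conicalʳ (G i a) _ (indicator-≉0⁻ _ ≉0))

  inTransitiveTriangle⇒arrowU : ∀ a b → InTransitiveTriangle G a b →
                                ArrowU F triangleAlgebra a b
  inTransitiveTriangle⇒arrowU a b (u , v , w , _ , uv , uw , vw , inj₁ (refl , refl)) =
    inj₁ (w , indicator-≉0 (transitiveTriangle-intro uv uw vw))
  inTransitiveTriangle⇒arrowU a b (u , v , w , _ , uv , uw , vw , inj₂ (inj₁ (refl , refl))) =
    inj₂ (inj₁ (v , indicator-≉0 (transitiveTriangle-intro uv uw vw)))
  inTransitiveTriangle⇒arrowU a b (u , v , w , _ , uv , uw , vw , inj₂ (inj₂ (refl , refl))) =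
    inj₂ (inj₂ (u , indicator-≉0 (transitiveTriangle-intro uv uw vw)))

corollary5p3 : ∀ {c ℓ : Level} (F : Field c ℓ) → AlgebraicallyClosed F → CharZero F →
    ∀ (n : ℕ) (G : Fin n → Fin n → Bool) →
    (∀ a b → G a b ≡ true → InTransitiveTriangle G a b) →
    ∃[ Ξ ] ∃[ ω ] ∃[ γ ] IsUnionDigraph F {n} γ G Ξ ω
corollary5p3 F _ _ n G everyArrowInTriangle =
  _ , _ , _ , isUnionDigraph transitiveTriangle G arrows
  where
    open IndicatorAlgebra F
    open TransitiveTriangleAlgebra F G

    arrows : ∀ a b → (G a b ≡ true) ⇔ ArrowU F triangleAlgebra a b
    arrows a b = mk⇔ (inTransitiveTriangle⇒arrowU a b ∘ everyArrowInTriangle a b)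
                     (arrowU⇒arrow a b)
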